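{- Let $M$ be a finite $R$-module and $N$ a finite $R'$-module, and let $A\subseteq R$, $B\subseteq R'$. Regarding $M\times N$ as a module over $R\times R'$, we have $C_{A\times B}(M\times N)\ge C_A(M)\,C_B(N)$.
   Context: $R,R'$ are rings with unity. For a finite $R$-module $M$, $A\subseteq R$ and a sequence $(x_1,\ldots,x_k)$ in $M$, an $A$-weighted zero-sum subsequence of consecutive terms is given by a non-empty set $I\subseteq[1,k]$ of consecutive integers and $a_i\in A$ ($i\in I$) with $\sum_{i\in I}a_ix_i=0$. $C_A(M)$ is the least positive integer $k$ such that every sequence in $M$ of length $k$ has an $A$-weighted zero-sum subsequence of consecutive terms. -}

module Defs where

open import Level using (Level; _⊔_)
open import Data.Nat using (ℕ; _≤_; _<_)
open import Data.Fin using (Fin)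
open import Data.Product using (Σ; ∃; ∃-syntax; _×_; _,_; proj₁; proj₂)
open import Data.Product.Relation.Binary.Pointwise.NonDependent using (_×ₛ_)
open import Data.List using (List; []; _∷_; _++_; length; map; foldr)
open import Data.List.Relation.Unary.All using (All)
open import Relation.Nullary using (¬_)
open import Relation.Unary using (Pred)
open import Relation.Binary.PropositionalEquality as ≡ using (_≡_; _≢_)
open import Function.Bundles using (Surjection)
open import Algebra.Bundles using (Ring)
open import Algebra.Module.Bundles using (LeftModule)
import Algebra.Construct.DirectProduct as DP

private variable r ℓr r′ ℓr′ m ℓm m′ ℓm′ a b : Level

_×ᴿ_ : Ring r ℓr → Ring r′ ℓr′ → Ring (r ⊔ r′) (ℓr ⊔ ℓr′)
R ×ᴿ R′ = DP.ring R R′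

_×ᴹ_ : {R : Ring r ℓr} {R′ : Ring r′ ℓr′} →
       LeftModule R m ℓm → LeftModule R′ m′ ℓm′ →
       LeftModule (R ×ᴿ R′) (m ⊔ m′) (ℓm ⊔ ℓm′)
_×ᴹ_ {R = R} {R′ = R′} M N = record
  { Carrierᴹ = M.Carrierᴹ × N.Carrierᴹ
  ; _≈ᴹ_ = λ p q → (proj₁ p M.≈ᴹ proj₁ q) × (proj₂ p N.≈ᴹ proj₂ q)
  ; _+ᴹ_ = λ p q → (proj₁ p M.+ᴹ proj₁ q) , (proj₂ p N.+ᴹ proj₂ q)
  ; _*ₗ_ = λ s p → (proj₁ s M.*ₗ proj₁ p) , (proj₂ s N.*ₗ proj₂ p)
  ; 0ᴹ = M.0ᴹ , N.0ᴹ
  ; -ᴹ_ = λ p → M.-ᴹ proj₁ p , N.-ᴹ proj₂ p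
  ; isLeftModule = record
    { isLeftSemimodule = record
      { +ᴹ-isCommutativeMonoid = record
        { isMonoid = record
          { isSemigroup = record
            { isMagma = record
              { isEquivalence = record
                { refl = M.≈ᴹ-refl , N.≈ᴹ-refl
                ; sym = λ (e , f) → M.≈ᴹ-sym e , N.≈ᴹ-sym f
                ; trans = λ (e , f) (e′ , f′) → M.≈ᴹ-trans e e′ , N.≈ᴹ-trans f f′
                }
              ; ∙-cong = λ (e , f) (e′ , f′) → M.+ᴹ-cong e e′ , N.+ᴹ-cong f f′
              }
            ; assoc = λ x y z → M.+ᴹ-assoc _ _ _ , N.+ᴹ-assoc _ _ _
            }
          ; identity = (λ x → M.+ᴹ-identityˡ _ , N.+ᴹ-identityˡ _)
                     , (λ x → M.+ᴹ-identityʳ _ , N.+ᴹ-identityʳ _)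
          }
        ; comm = λ x y → M.+ᴹ-comm _ _ , N.+ᴹ-comm _ _
        }
      ; isPreleftSemimodule = record
        { *ₗ-cong = λ (e , f) (e′ , f′) → M.*ₗ-cong e e′ , N.*ₗ-cong f f′
        ; *ₗ-zeroˡ = λ x → M.*ₗ-zeroˡ _ , N.*ₗ-zeroˡ _
        ; *ₗ-distribʳ = λ x s t → M.*ₗ-distribʳ _ _ _ , N.*ₗ-distribʳ _ _ _
        ; *ₗ-identityˡ = λ x → M.*ₗ-identityˡ _ , N.*ₗ-identityˡ _
        ; *ₗ-assoc = λ s t x → M.*ₗ-assoc _ _ _ , N.*ₗ-assoc _ _ _
        ; *ₗ-zeroʳ = λ s → M.*ₗ-zeroʳ _ , N.*ₗ-zeroʳ _
        ; *ₗ-distribˡ = λ s x y → M.*ₗ-distribˡ _ _ _ , N.*ₗ-distribˡ _ _ _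
        }
      }
    ; -ᴹ‿cong = λ (e , f) → M.-ᴹ‿cong e , N.-ᴹ‿cong f
    ; -ᴹ‿inverse = (λ x → M.-ᴹ‿inverseˡ _ , N.-ᴹ‿inverseˡ _)
                 , (λ x → M.-ᴹ‿inverseʳ _ , N.-ᴹ‿inverseʳ _)
    }
  }
  where
  module M = LeftModule M
  module N = LeftModule N

_×ˢ_ : {X : Set r} {Y : Set r′} → Pred X a → Pred Y b → Pred (X × Y) (a ⊔ b)
(A ×ˢ B) p = A (proj₁ p) × B (proj₂ p)

module _ {R : Ring r ℓr} (M : LeftModule R m ℓm) where
  open Ring R using (Carrier)
  open LeftModule M

  FiniteModule : Set (m ⊔ ℓm)
  FiniteModule = ∃[ n ] Surjection (≡.setoid (Fin n)) ≈ᴹ-setoid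

  weightedSum : List (Carrier × Carrierᴹ) → Carrierᴹ
  weightedSum = foldr (λ p s → (proj₁ p *ₗ proj₂ p) +ᴹ s) 0ᴹ

  HasWeightedZeroSumConsec : ∀ {a} → Pred Carrier a → List Carrierᴹ → Set (r ⊔ m ⊔ ℓm ⊔ a)
  HasWeightedZeroSumConsec A xs =
    ∃[ pre ] ∃[ mid ] ∃[ post ] (xs ≡ pre ++ mid ++ post) × (mid ≢ []) ×
      ∃[ w ] (map proj₂ w ≡ mid) × All (λ p → A (proj₁ p)) w × (weightedSum w ≈ᴹ 0ᴹ)

  AllSeqsHaveZS : ∀ {a} → Pred Carrier a → ℕ → Set (r ⊔ m ⊔ ℓm ⊔ a)
  AllSeqsHaveZS A k = (xs : List Carrierᴹ) → length xs ≡ k → HasWeightedZeroSumConsec A xs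

  -- IsC A k  :⇔  k = C_A(M), i.e. k is the least positive integer with AllSeqsHaveZS A k.
  IsC : ∀ {a} → Pred Carrier a → ℕ → Set (r ⊔ m ⊔ ℓm ⊔ a)
  IsC A k = (1 ≤ k) × AllSeqsHaveZS A k × (∀ j → 1 ≤ j → j < k → ¬ AllSeqsHaveZS A j)

-- Write C_A(M) = p + 1 and C_B(N) = q + 1, and let x (length p) and y (length q) have no
-- weighted zero-sum block. Embedding x_i as (x_i , 0) and y_j as (0 , y_j), the sequence
-- x, y₁, x, y₂, …, y_q, x in M × N has length (p + 1)(q + 1) − 1 and no (A × B)-weighted
-- zero-sum block: the second components of a block meeting some y_j give a B-weighted zero-sum
-- block of y, and a block meeting none lies inside one copy of x.
-- Minimality of C only refutes that all sequences have zero-sum blocks; finiteness of N turns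
-- this into the double negation of an explicit bad y, which suffices since the goal is a
-- contradiction.
module Submission where

open import Defs
open import Level using (Level)
open import Data.Nat using (ℕ; zero; suc; _+_; _*_; _≤_; _<_; _≥_; s≤s; z≤n)
open import Data.Nat.Properties
  using (suc-injective; ≮⇒≥; *-comm; m≤n⇒m⊓n≡m; +-identityʳ; ≤-refl; ≤-trans; ≤-reflexive; ≤-pred)
open import Data.Fin using (Fin; zero; suc)
open import Data.Product using (∃₂; ∃-syntax; _×_; _,_; proj₁; proj₂)
open import Data.Sum using (_⊎_; inj₁; inj₂; [_,_]; [_,_]′; isInj₁; isInj₂)
open import Data.Empty using (⊥-elim)
open import Data.List using (List; []; _∷_; _++_; length; map; mapMaybe; take; drop)
open import Data.List.Properties
  using (∷-injective; ++-assoc; ++-conicalˡ; ++-conicalʳ; length-++; length-map; length-take;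
         take++drop≡id; mapMaybe-++; mapMaybeIsInj₁∘mapInj₁; mapMaybeIsInj₂∘mapInj₁)
open import Data.List.Relation.Unary.All using (All; []; _∷_)
open import Data.List.Relation.Binary.Pointwise using (Pointwise; []; _∷_)
open import Relation.Nullary using (¬_)
open import Relation.Unary using (Pred)
open import Relation.Binary.Core using (REL)
open import Relation.Binary.PropositionalEquality
  using (_≡_; _≢_; refl; sym; trans; cong; cong₂; subst; module ≡-Reasoning)
open import Function using (id; _∘_; case_of_)
open import Function.Bundles using (Surjection)
open import Algebra.Bundles using (Ring)
open import Algebra.Module.Bundles using (LeftModule)

¬¬-∀-Fin : ∀ {ℓ} n {P : Fin n → Set ℓ} → (∀ i → ¬ ¬ P i) → ¬ ¬ (∀ i → P i)
¬¬-∀-Fin zero    _   ¬∀ = ¬∀ λ ()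
¬¬-∀-Fin (suc n) ¬¬P ¬∀ =
  ¬¬P zero λ P₀ → ¬¬-∀-Fin n (¬¬P ∘ suc) λ P₊ → ¬∀ λ { zero → P₀ ; (suc i) → P₊ i }

¬¬-∀-List-Fin : ∀ {ℓ} n k {P : List (Fin n) → Set ℓ} →
  (∀ v → length v ≡ k → ¬ ¬ P v) → ¬ ¬ (∀ v → length v ≡ k → P v)
¬¬-∀-List-Fin n zero    ¬¬P ¬∀ = ¬¬P [] refl λ P[] → ¬∀ λ { [] _ → P[] }
¬¬-∀-List-Fin n (suc k) {P} ¬¬P ¬∀ =
  ¬¬-∀-Fin n (λ i → ¬¬-∀-List-Fin n k {P ∘ (i ∷_)} λ v |v| → ¬¬P (i ∷ v) (cong suc |v|))
    λ P∷ → ¬∀ λ { (i ∷ v) |v| → P∷ i v (suc-injective |v|) }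

module _ {ℓ} {X : Set ℓ} where

  prefix-++-∷ : ∀ (L₁ : List X) c L₂ mid post → L₁ ++ c ∷ L₂ ≡ mid ++ post →
    (∃[ post′ ] L₁ ≡ mid ++ post′) ⊎ (∃[ m₂ ] mid ≡ L₁ ++ c ∷ m₂)
  prefix-++-∷ L₁       c L₂ []        post e = inj₁ (L₁ , refl)
  prefix-++-∷ []       c L₂ (d ∷ mid) post e with ∷-injective e
  ... | refl , _ = inj₂ (mid , refl)
  prefix-++-∷ (a ∷ L₁) c L₂ (d ∷ mid) post e with ∷-injective e
  ... | refl , e′ with prefix-++-∷ L₁ c L₂ mid post e′
  ... | inj₁ (post′ , refl) = inj₁ (post′ , refl)
  ... | inj₂ (m₂ , refl)    = inj₂ (m₂ , refl)

  infix-++-∷ : ∀ (L₁ : List X) c L₂ pre mid post → L₁ ++ c ∷ L₂ ≡ pre ++ mid ++ post →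
    (∃₂ λ pre′ post′ → L₁ ≡ pre′ ++ mid ++ post′) ⊎
    (∃₂ λ pre′ post′ → L₂ ≡ pre′ ++ mid ++ post′) ⊎
    (∃₂ λ m₁ m₂ → mid ≡ m₁ ++ c ∷ m₂)
  infix-++-∷ L₁ c L₂ [] mid post e with prefix-++-∷ L₁ c L₂ mid post e
  ... | inj₁ (post′ , e′) = inj₁ ([] , post′ , e′)
  ... | inj₂ (m₂ , e′)    = inj₂ (inj₂ (L₁ , m₂ , e′))
  infix-++-∷ []       c L₂ (d ∷ pre) mid post e =
    inj₂ (inj₁ (pre , post , proj₂ (∷-injective e)))
  infix-++-∷ (a ∷ L₁) c L₂ (d ∷ pre) mid post e
    with infix-++-∷ L₁ c L₂ pre mid post (proj₂ (∷-injective e))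
  ... | inj₁ (pre′ , post′ , e′) = inj₁ (a ∷ pre′ , post′ , cong (a ∷_) e′)
  ... | inj₂ r                   = inj₂ r

module _ {a b} {X : Set a} {Y : Set b} where

  map-++⁻ : ∀ (f : X → Y) l P Q → map f l ≡ P ++ Q →
    ∃₂ λ P′ Q′ → l ≡ P′ ++ Q′ × map f P′ ≡ P × map f Q′ ≡ Q
  map-++⁻ f l       []      Q e = [] , l , refl , refl , e
  map-++⁻ f (x ∷ l) (p ∷ P) Q e with ∷-injective e
  ... | refl , e′ with map-++⁻ f l P Q e′
  ... | P′ , Q′ , refl , refl , e″ = x ∷ P′ , Q′ , refl , refl , e″

  map-infix⁻ : ∀ (f : X → Y) l pre mid post → map f l ≡ pre ++ mid ++ post →
    ∃[ pre′ ] ∃[ mid′ ] ∃[ post′ ] l ≡ pre′ ++ mid′ ++ post′ × map f mid′ ≡ mid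
  map-infix⁻ f l pre mid post e with map-++⁻ f l pre (mid ++ post) e
  ... | pre′ , rest , refl , _ , e′ with map-++⁻ f rest mid post e′
  ... | mid′ , post′ , refl , e″ , _ = pre′ , mid′ , post′ , refl , e″

  Pointwise-++⁻ : ∀ {ℓʳ} {R : REL X Y ℓʳ} l₁ l₂ {ys} → Pointwise R (l₁ ++ l₂) ys →
    ∃₂ λ ys₁ ys₂ → ys ≡ ys₁ ++ ys₂ × Pointwise R l₁ ys₁ × Pointwise R l₂ ys₂
  Pointwise-++⁻ []       l₂ rs = [] , _ , refl , [] , rs
  Pointwise-++⁻ (x ∷ l₁) l₂ (r ∷ rs) with Pointwise-++⁻ l₁ l₂ rs
  ... | ys₁ , ys₂ , refl , rs₁ , rs₂ = _ ∷ ys₁ , ys₂ , refl , r ∷ rs₁ , rs₂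

module _ {a b} {X : Set a} {Y : Set b} where

  interleave : List X → List Y → List (X ⊎ Y)
  interleave xs []       = map inj₁ xs
  interleave xs (y ∷ ys) = map inj₁ xs ++ inj₂ y ∷ interleave xs ys

  length-interleave : ∀ xs ys →
    suc (length (interleave xs ys)) ≡ suc (length ys) * suc (length xs)
  length-interleave xs [] = cong suc (trans (length-map inj₁ xs) (sym (+-identityʳ _)))
  length-interleave xs (y ∷ ys) = begin
    suc (length (map inj₁ xs ++ inj₂ y ∷ interleave xs ys))
      ≡⟨ cong suc (length-++ (map inj₁ xs)) ⟩
    suc (length (map inj₁ xs)) + suc (length (interleave xs ys))
      ≡⟨ cong₂ _+_ (cong suc (length-map inj₁ xs)) (length-interleave xs ys) ⟩
    suc (length xs) + suc (length ys) * suc (length xs)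
      ∎
    where open ≡-Reasoning

  mapMaybe-isInj₂-interleave : ∀ xs ys → mapMaybe isInj₂ (interleave xs ys) ≡ ys
  mapMaybe-isInj₂-interleave xs [] = mapMaybeIsInj₂∘mapInj₁ xs
  mapMaybe-isInj₂-interleave xs (y ∷ ys) = begin
    mapMaybe isInj₂ (map inj₁ xs ++ inj₂ y ∷ interleave xs ys)
      ≡⟨ mapMaybe-++ isInj₂ (map inj₁ xs) _ ⟩
    mapMaybe isInj₂ (map inj₁ xs) ++ y ∷ mapMaybe isInj₂ (interleave xs ys)
      ≡⟨ cong₂ (λ l r → l ++ y ∷ r) (mapMaybeIsInj₂∘mapInj₁ xs) (mapMaybe-isInj₂-interleave xs ys) ⟩
    y ∷ ys
      ∎
    where open ≡-Reasoning

  interleave-infix : ∀ xs ys pre mid post → interleave xs ys ≡ pre ++ mid ++ post →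
    (∃[ pre′ ] ∃[ mid′ ] ∃[ post′ ] xs ≡ pre′ ++ mid′ ++ post′ × map inj₁ mid′ ≡ mid) ⊎
    mapMaybe isInj₂ mid ≢ []
  interleave-infix xs [] pre mid post e = inj₁ (map-infix⁻ inj₁ xs pre mid post e)
  interleave-infix xs (y ∷ ys) pre mid post e
    with infix-++-∷ (map inj₁ xs) (inj₂ y) (interleave xs ys) pre mid post e
  ... | inj₁ (pre′ , post′ , e′)        = inj₁ (map-infix⁻ inj₁ xs pre′ mid post′ e′)
  ... | inj₂ (inj₁ (pre′ , post′ , e′)) = interleave-infix xs ys pre′ mid post′ e′
  ... | inj₂ (inj₂ (m₁ , m₂ , refl))    = inj₂ λ isInj₂-mid≡[] →
    case ++-conicalʳ (mapMaybe isInj₂ m₁) _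
           (trans (sym (mapMaybe-++ isInj₂ m₁ (inj₂ y ∷ m₂))) isInj₂-mid≡[]) of λ ()

module ZeroSums {r ℓr m ℓm a} {R : Ring r ℓr}
    (M : LeftModule R m ℓm) (A : Pred (Ring.Carrier R) a) where
  open Ring R using () renaming (refl to ≈-refl)
  open LeftModule M

  WeightedZeroSum : List Carrierᴹ → Set _
  WeightedZeroSum mid =
    ∃[ w ] (map proj₂ w ≡ mid) × All (λ p → A (proj₁ p)) w × (weightedSum M w ≈ᴹ 0ᴹ)

  weightedSum-resp : ∀ w {mid′} → Pointwise _≈ᴹ_ (map proj₂ w) mid′ → All (λ p → A (proj₁ p)) w →
    ∃[ w′ ] (map proj₂ w′ ≡ mid′) × All (λ p → A (proj₁ p)) w′ ×
      (weightedSum M w′ ≈ᴹ weightedSum M w)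
  weightedSum-resp []            []       []          = [] , refl , [] , ≈ᴹ-refl
  weightedSum-resp ((s , x) ∷ w) (e ∷ pw) (s∈A ∷ w∈A) with weightedSum-resp w pw w∈A
  ... | w′ , refl , w′∈A , w′≈w =
    (s , _) ∷ w′ , refl , s∈A ∷ w′∈A , +ᴹ-cong (*ₗ-cong ≈-refl (≈ᴹ-sym e)) w′≈w

  WeightedZeroSum-resp : ∀ {mid mid′} → Pointwise _≈ᴹ_ mid mid′ →
    WeightedZeroSum mid → WeightedZeroSum mid′
  WeightedZeroSum-resp pw (w , refl , w∈A , w≈0) with weightedSum-resp w pw w∈A
  ... | w′ , e , w′∈A , w′≈w = w′ , e , w′∈A , ≈ᴹ-trans w′≈w w≈0

  HasWeightedZeroSumConsec-resp : ∀ {xs ys} → Pointwise _≈ᴹ_ xs ys →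
    HasWeightedZeroSumConsec M A xs → HasWeightedZeroSumConsec M A ys
  HasWeightedZeroSumConsec-resp pw (pre , mid , post , refl , mid≢[] , zs)
    with Pointwise-++⁻ pre (mid ++ post) pw
  ... | pre′ , rest , refl , _ , pw′ with Pointwise-++⁻ mid post pw′
  ... | mid′ , post′ , refl , pwₘ , _ =
    pre′ , mid′ , post′ , refl , (λ { refl → mid≢[] (Pointwise-[]ʳ pwₘ) }) ,
    WeightedZeroSum-resp pwₘ zs
    where
    Pointwise-[]ʳ : ∀ {l} → Pointwise _≈ᴹ_ l [] → l ≡ []
    Pointwise-[]ʳ [] = refl

  ¬HasWeightedZeroSumConsec-[] : ¬ HasWeightedZeroSumConsec M A []
  ¬HasWeightedZeroSumConsec-[] (pre , mid , post , e , mid≢[] , _) =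
    mid≢[] (++-conicalˡ mid post (++-conicalʳ pre (mid ++ post) (sym e)))

  HasWeightedZeroSumConsec-++ : ∀ {xs} → HasWeightedZeroSumConsec M A xs → ∀ zs →
    HasWeightedZeroSumConsec M A (xs ++ zs)
  HasWeightedZeroSumConsec-++ (pre , mid , post , refl , mid≢[] , zs) ext =
    pre , mid , post ++ ext ,
    trans (++-assoc pre (mid ++ post) ext) (cong (pre ++_) (++-assoc mid post ext)) ,
    mid≢[] , zs

  AllSeqsHaveZS⇒HasWeightedZeroSumConsec : ∀ {k} → AllSeqsHaveZS M A k →
    ∀ xs → k ≤ length xs → HasWeightedZeroSumConsec M A xs
  AllSeqsHaveZS⇒HasWeightedZeroSumConsec {k} all xs k≤|xs| =
    subst (HasWeightedZeroSumConsec M A) (take++drop≡id k xs)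
      (HasWeightedZeroSumConsec-++ (all (take k xs) |take|) (drop k xs))
    where
    |take| : length (take k xs) ≡ k
    |take| = trans (length-take k xs) (m≤n⇒m⊓n≡m k≤|xs|)

  IsC⇒¬AllSeqsHaveZS-pred : ∀ {p} → IsC M A (suc p) → ¬ AllSeqsHaveZS M A p
  IsC⇒¬AllSeqsHaveZS-pred {zero}  _ all = ¬HasWeightedZeroSumConsec-[] (all [] refl)
  IsC⇒¬AllSeqsHaveZS-pred {suc p} (_ , _ , minimal) = minimal (suc p) (s≤s z≤n) ≤-refl

  ¬¬-badSequence : FiniteModule M → ∀ {k} → ¬ AllSeqsHaveZS M A k →
    ¬ ¬ (∃[ xs ] length xs ≡ k × ¬ HasWeightedZeroSumConsec M A xs)
  ¬¬-badSequence (n , S) {k} ¬all noBad =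
    ¬¬-∀-List-Fin n k
      (λ v |v| ¬zs → noBad (map to v , trans (length-map to v) |v| , ¬zs))
      (λ all → ¬all λ xs |xs| → let v , |v|≡|xs| , pw = preimage xs in
        HasWeightedZeroSumConsec-resp pw (all v (trans |v|≡|xs| |xs|)))
    where
    open Surjection S using (to; strictlySurjective)
    preimage : ∀ xs → ∃[ v ] length v ≡ length xs × Pointwise _≈ᴹ_ (map to v) xs
    preimage []       = [] , refl , []
    preimage (x ∷ xs) with strictlySurjective x | preimage xs
    ... | i , toi≈x | v , |v| , pw = i ∷ v , cong suc |v| , toi≈x ∷ pw

module Products {r ℓr r′ ℓr′ m ℓm m′ ℓm′ a b}
    {R : Ring r ℓr} {R′ : Ring r′ ℓr′}
    (M : LeftModule R m ℓm) (N : LeftModule R′ m′ ℓm′)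
    (A : Pred (Ring.Carrier R) a) (B : Pred (Ring.Carrier R′) b) where
  private
    module M = LeftModule M
    module N = LeftModule N
  open ZeroSums using (WeightedZeroSum)

  embed : M.Carrierᴹ ⊎ N.Carrierᴹ → M.Carrierᴹ × N.Carrierᴹ
  embed = [ (_, N.0ᴹ) , (M.0ᴹ ,_) ]

  weightedSum-isInj₁ : ∀ mid w → map proj₂ w ≡ map embed mid → All (λ p → (A ×ˢ B) (proj₁ p)) w →
    ∃[ u ] (map proj₂ u ≡ mapMaybe isInj₁ mid) × All (λ p → A (proj₁ p)) u ×
      (proj₁ (weightedSum (M ×ᴹ N) w) M.≈ᴹ weightedSum M u)
  weightedSum-isInj₁ []            []            _ []            = [] , refl , [] , M.≈ᴹ-refl
  weightedSum-isInj₁ (inj₁ x ∷ mid) ((s , _) ∷ w) e (s∈A×B ∷ w∈A×B) with ∷-injective e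
  ... | refl , e′ with weightedSum-isInj₁ mid w e′ w∈A×B
  ... | u , eu , u∈A , w≈u =
    (proj₁ s , x) ∷ u , cong (x ∷_) eu , proj₁ s∈A×B ∷ u∈A , M.+ᴹ-cong M.≈ᴹ-refl w≈u
  weightedSum-isInj₁ (inj₂ y ∷ mid) ((s , _) ∷ w) e (_ ∷ w∈A×B) with ∷-injective e
  ... | refl , e′ with weightedSum-isInj₁ mid w e′ w∈A×B
  ... | u , eu , u∈A , w≈u =
    u , eu , u∈A , M.≈ᴹ-trans (M.+ᴹ-cong (M.*ₗ-zeroʳ _) w≈u) (M.+ᴹ-identityˡ _)

  weightedSum-isInj₂ : ∀ mid w → map proj₂ w ≡ map embed mid → All (λ p → (A ×ˢ B) (proj₁ p)) w →
    ∃[ u ] (map proj₂ u ≡ mapMaybe isInj₂ mid) × All (λ p → B (proj₁ p)) u ×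
      (proj₂ (weightedSum (M ×ᴹ N) w) N.≈ᴹ weightedSum N u)
  weightedSum-isInj₂ []            []            _ []            = [] , refl , [] , N.≈ᴹ-refl
  weightedSum-isInj₂ (inj₂ y ∷ mid) ((s , _) ∷ w) e (s∈A×B ∷ w∈A×B) with ∷-injective e
  ... | refl , e′ with weightedSum-isInj₂ mid w e′ w∈A×B
  ... | u , eu , u∈B , w≈u =
    (proj₂ s , y) ∷ u , cong (y ∷_) eu , proj₂ s∈A×B ∷ u∈B , N.+ᴹ-cong N.≈ᴹ-refl w≈u
  weightedSum-isInj₂ (inj₁ x ∷ mid) ((s , _) ∷ w) e (_ ∷ w∈A×B) with ∷-injective e
  ... | refl , e′ with weightedSum-isInj₂ mid w e′ w∈A×B
  ... | u , eu , u∈B , w≈u =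
    u , eu , u∈B , N.≈ᴹ-trans (N.+ᴹ-cong (N.*ₗ-zeroʳ _) w≈u) (N.+ᴹ-identityˡ _)

  WeightedZeroSum-isInj₁ : ∀ mid → WeightedZeroSum (M ×ᴹ N) (A ×ˢ B) (map embed mid) →
    WeightedZeroSum M A (mapMaybe isInj₁ mid)
  WeightedZeroSum-isInj₁ mid (w , e , w∈A×B , w≈0) with weightedSum-isInj₁ mid w e w∈A×B
  ... | u , eu , u∈A , w≈u = u , eu , u∈A , M.≈ᴹ-trans (M.≈ᴹ-sym w≈u) (proj₁ w≈0)

  WeightedZeroSum-isInj₂ : ∀ mid → WeightedZeroSum (M ×ᴹ N) (A ×ˢ B) (map embed mid) →
    WeightedZeroSum N B (mapMaybe isInj₂ mid)
  WeightedZeroSum-isInj₂ mid (w , e , w∈A×B , w≈0) with weightedSum-isInj₂ mid w e w∈A×B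
  ... | u , eu , u∈B , w≈u = u , eu , u∈B , N.≈ᴹ-trans (N.≈ᴹ-sym w≈u) (proj₂ w≈0)

  interleave-HasWeightedZeroSumConsec : ∀ xs ys →
    HasWeightedZeroSumConsec (M ×ᴹ N) (A ×ˢ B) (map embed (interleave xs ys)) →
    HasWeightedZeroSumConsec M A xs ⊎ HasWeightedZeroSumConsec N B ys
  interleave-HasWeightedZeroSumConsec xs ys (pre , mid , post , e , mid≢[] , zs)
    with map-infix⁻ embed (interleave xs ys) pre mid post e
  ... | pre′ , mid′ , post′ , e′ , refl with interleave-infix xs ys pre′ mid′ post′ e′
  ... | inj₁ (pre₁ , mid₁ , post₁ , e₁ , refl) =
    inj₁ (pre₁ , mid₁ , post₁ , e₁ , (λ { refl → mid≢[] refl }) ,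
          subst (WeightedZeroSum M A) (mapMaybeIsInj₁∘mapInj₁ mid₁)
            (WeightedZeroSum-isInj₁ (map inj₁ mid₁) zs))
  ... | inj₂ isInj₂-mid′≢[] =
    inj₂ (mapMaybe isInj₂ pre′ , mapMaybe isInj₂ mid′ , mapMaybe isInj₂ post′ , ys≡ ,
          isInj₂-mid′≢[] , WeightedZeroSum-isInj₂ mid′ zs)
    where
    open ≡-Reasoning
    ys≡ : ys ≡ mapMaybe isInj₂ pre′ ++ mapMaybe isInj₂ mid′ ++ mapMaybe isInj₂ post′
    ys≡ = begin
      ys
        ≡⟨ sym (mapMaybe-isInj₂-interleave xs ys) ⟩
      mapMaybe isInj₂ (interleave xs ys)
        ≡⟨ cong (mapMaybe isInj₂) e′ ⟩
      mapMaybe isInj₂ (pre′ ++ mid′ ++ post′)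
        ≡⟨ mapMaybe-++ isInj₂ pre′ _ ⟩
      mapMaybe isInj₂ pre′ ++ mapMaybe isInj₂ (mid′ ++ post′)
        ≡⟨ cong (mapMaybe isInj₂ pre′ ++_) (mapMaybe-++ isInj₂ mid′ post′) ⟩
      mapMaybe isInj₂ pre′ ++ mapMaybe isInj₂ mid′ ++ mapMaybe isInj₂ post′
        ∎

  ¬AllSeqsHaveZS-×ᴹ : FiniteModule N → ∀ {p q} → ¬ AllSeqsHaveZS M A p → ¬ AllSeqsHaveZS N B q →
    ∀ {k} → k < suc p * suc q → ¬ AllSeqsHaveZS (M ×ᴹ N) (A ×ˢ B) k
  ¬AllSeqsHaveZS-×ᴹ finN {p} {q} ¬allM ¬allN {k} k<pq allMN =
    ZeroSums.¬¬-badSequence N B finN ¬allN λ (ys , |ys| , ¬zs-ys) →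
      ¬allM λ xs |xs| → [ id , ⊥-elim ∘ ¬zs-ys ]′
        (interleave-HasWeightedZeroSumConsec xs ys
          (ZeroSums.AllSeqsHaveZS⇒HasWeightedZeroSumConsec (M ×ᴹ N) (A ×ˢ B) allMN _
            (≤-pred (≤-trans k<pq (≤-reflexive (length-embed-interleave xs ys |xs| |ys|))))))
    where
    open ≡-Reasoning
    length-embed-interleave : ∀ xs ys → length xs ≡ p → length ys ≡ q →
      suc p * suc q ≡ suc (length (map embed (interleave xs ys)))
    length-embed-interleave xs ys |xs| |ys| = begin
      suc p * suc q                                 ≡⟨ *-comm (suc p) (suc q) ⟩
      suc q * suc p                                 ≡⟨ sym (cong₂ (λ i j → suc j * suc i) |xs| |ys|) ⟩
      suc (length ys) * suc (length xs)             ≡⟨ sym (length-interleave xs ys) ⟩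
      suc (length (interleave xs ys))               ≡⟨ cong suc (sym (length-map embed (interleave xs ys))) ⟩
      suc (length (map embed (interleave xs ys)))   ∎

mainTheorem9 : ∀ {r ℓr r′ ℓr′ m ℓm m′ ℓm′ a b : Level}
    (R : Ring r ℓr) (R′ : Ring r′ ℓr′)
    (M : LeftModule R m ℓm) (N : LeftModule R′ m′ ℓm′) →
    FiniteModule M → FiniteModule N →
    (A : Pred (Ring.Carrier R) a) (B : Pred (Ring.Carrier R′) b) →
    (cM cN cMN : ℕ) →
    IsC M A cM → IsC N B cN → IsC (M ×ᴹ N) (A ×ˢ B) cMN →
    cMN ≥ cM * cN
mainTheorem9 _ _ _ _ _ _ _ _ zero    _       _ (() , _) _ _
mainTheorem9 _ _ _ _ _ _ _ _ (suc _) zero    _ _ (() , _) _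
mainTheorem9 _ _ M N _ finN A B (suc p) (suc q) cMN C-M C-N (_ , allMN , _) =
  ≮⇒≥ λ cMN<cM*cN →
    Products.¬AllSeqsHaveZS-×ᴹ M N A B finN
      (ZeroSums.IsC⇒¬AllSeqsHaveZS-pred M A C-M) (ZeroSums.IsC⇒¬AllSeqsHaveZS-pred N B C-N)
      cMN<cM*cN allMN
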